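{- Let $f\colon 2^{\mathcal{N}} \to \mathbb{R}^+$ be a non-negative symmetric submodular function with multilinear extension $F$. Let $S \subseteq \mathcal{N}$ and let $x \in [0,1]^{\mathcal{N}}$ be a vector such that $F(y) \leq F(x)$ for every $y \in [0,1]^{\mathcal{N}}$ with $y \leq x$ (coordinate-wise). Then $F(\mathbf{1}_S \vee x) \geq f(S) - F(x)$.
   Context: $f$ is submodular if $f(A)+f(B)\ge f(A\cup B)+f(A\cap B)$ for all $A,B\subseteq\mathcal{N}$ and symmetric if $f(S)=f(\mathcal{N}\setminus S)$. The multilinear extension is $F(x)=\mathbb{E}[f(R(x))]$ where $R(x)$ contains each $u\in\mathcal{N}$ independently with probability $x_u$. $\mathbf{1}_S$ is the characteristic vector of $S$, and $x\vee y$ denotes the coordinate-wise maximum. -}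

module Defs where

open import Level using (Level; suc; _⊔_)
open import Data.Bool using (Bool; true; false; if_then_else_)
open import Data.Nat using (ℕ; zero) renaming (suc to sucℕ)
open import Data.Fin using (Fin)
import Data.Fin as Fin
open import Data.Fin.Subset using (Subset; _∪_; _∩_; ∁)
open import Data.Vec using (Vec; []; _∷_; lookup)
open import Data.List using (List; []; _∷_; _++_; map; foldr)
open import Data.Product using (Σ)
open import Relation.Binary.PropositionalEquality using (_≡_)
open import Relation.Binary.Structures using (IsTotalOrder)
open import Relation.Nullary using (¬_)
open import Algebra.Structures using (IsCommutativeRing)

-- An ordered field (the real numbers ℝ are one; the paper's f takes values in ℝ).
record OrderedField (c ℓ : Level) : Set (suc (c ⊔ ℓ)) where
  infixl 6 _+_ _-_
  infixl 7 _*_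
  infix  4 _≤_
  field
    Carrier : Set c
    _+_ _*_ : Carrier → Carrier → Carrier
    -_      : Carrier → Carrier
    0# 1#   : Carrier
    _≤_     : Carrier → Carrier → Set ℓ
    isCommutativeRing : IsCommutativeRing _≡_ _+_ _*_ -_ 0# 1#
    isTotalOrder      : IsTotalOrder _≡_ _≤_
    0≢1     : ¬ (0# ≡ 1#)
    inverse : ∀ a → ¬ (a ≡ 0#) → Σ Carrier (λ b → a * b ≡ 1#)
    +-mono-≤ : ∀ {a b} c → a ≤ b → a + c ≤ b + c
    *-nonneg : ∀ {a b} → 0# ≤ a → 0# ≤ b → 0# ≤ a * b

  _-_ : Carrier → Carrier → Carrier
  a - b = a + (- b)

-- All subsets of the ground set 𝒩 = Fin n (each exactly once).
allSubsets : (n : ℕ) → List (Subset n)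
allSubsets zero = [] ∷ []
allSubsets (sucℕ n) = map (true ∷_) (allSubsets n) ++ map (false ∷_) (allSubsets n)

module _ {c ℓ : Level} (K : OrderedField c ℓ) where
  open OrderedField K

  sumL : List Carrier → Carrier
  sumL = foldr _+_ 0#

  prodFin : (n : ℕ) → (Fin n → Carrier) → Carrier
  prodFin zero g = 1#
  prodFin (sucℕ n) g = g Fin.zero * prodFin n (λ i → g (Fin.suc i))

  _∈?_ : {n : ℕ} → Fin n → Subset n → Bool
  u ∈? A = lookup A u

  prob : {n : ℕ} → (Fin n → Carrier) → Subset n → Carrier
  prob {n} x A = prodFin n (λ u → if u ∈? A then x u else 1# - x u)

  -- multilinear extension F(x) = E[f(R(x))] = Σ_A f(A) Pr[R(x) = A]
  multilinear : {n : ℕ} → (Subset n → Carrier) → (Fin n → Carrier) → Carrier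
  multilinear {n} f x = sumL (map (λ A → f A * prob x A) (allSubsets n))

  -- 1_S ∨ x (coordinate-wise max); for x ∈ [0,1]^𝒩, max(1, x_u) = 1 and max(0, x_u) = x_u
  charJoin : {n : ℕ} → Subset n → (Fin n → Carrier) → (Fin n → Carrier)
  charJoin S x u = if u ∈? S then 1# else x u

  NonNegative : {n : ℕ} → (Subset n → Carrier) → Set ℓ
  NonNegative f = ∀ A → 0# ≤ f A

  Symmetric : {n : ℕ} → (Subset n → Carrier) → Set c
  Symmetric f = ∀ A → f A ≡ f (∁ A)

  Submodular : {n : ℕ} → (Subset n → Carrier) → Set ℓ
  Submodular f = ∀ A B → f (A ∪ B) + f (A ∩ B) ≤ f A + f B

  InUnitCube : {n : ℕ} → (Fin n → Carrier) → Set ℓ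
  InUnitCube x = ∀ u → (0# ≤ x u) Data.Product.× (x u ≤ 1#)

module Submission where

-- Let y be x with the coordinates in S
-- set to 0.  Draw one random set A ⊆ 𝒩 ∖ S, containing each u ∉ S with
-- probability x_u.  Then S ∪ A is distributed as R(1_S ∨ x) and A as R(y),
-- so by linearity of expectation
--     F(1_S ∨ x) + F(y) = 𝔼[f(S ∪ A) + f(A)].
-- For every A disjoint from S, symmetry, submodularity and non-negativity
-- give f(S ∪ A) + f(A) = f(S ∪ A) + f(𝒩 ∖ A) ≥ f(𝒩) + f(S) ≥ f(S), because
-- (S ∪ A) ∩ (𝒩 ∖ A) = S.  Hence F(1_S ∨ x) + F(y) ≥ f(S); since y ≤ x
-- coordinate-wise, local optimality of x gives F(y) ≤ F(x), and the claim
-- follows.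

open import Defs
open import Level using (Level)
open import Data.Nat using (ℕ) renaming (zero to zeroℕ; suc to sucℕ)
open import Data.Fin using (Fin) renaming (zero to fzero; suc to fsuc)
open import Data.Fin.Subset using (Subset; _∪_; _∩_; ∁)
open import Data.Bool using (Bool; true; false; if_then_else_)
open import Data.Vec using ([]; _∷_)
open import Data.List using (List; []; _∷_; _++_; map)
open import Data.List.Properties using (map-++; map-∘)
open import Data.Product using (_,_; proj₁; proj₂)
open import Data.Sum using (inj₁; inj₂)
open import Data.Empty using (⊥-elim)
open import Function using (_∘_)
open import Relation.Binary.PropositionalEquality
  using (_≡_; refl; sym; trans; cong; cong₂)
open import Relation.Binary.Bundles using (Poset)
open import Relation.Binary.Structures using (IsTotalOrder)
open import Algebra.Bundles using (CommutativeRing)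
import Algebra.Properties.Ring as RingProperties
import Algebra.Properties.Group as GroupProperties
import Algebra.Properties.CommutativeSemigroup as CommutativeSemigroupProperties
import Relation.Binary.Reasoning.PartialOrder as PosetReasoning

-- `Disjoint S A` : the subsets S and A of Fin n do not intersect.  Stated
-- inductively so that the coupling lemma can recurse on it coordinate-wise.
data Disjoint : {n : ℕ} → Subset n → Subset n → Set where
  []    : Disjoint [] []
  out∷_ : ∀ {n} {S A : Subset n} {b : Bool} → Disjoint S A → Disjoint (false ∷ S) (b ∷ A)
  in∷_  : ∀ {n} {S A : Subset n} → Disjoint S A → Disjoint (true ∷ S) (false ∷ A)

∪-∩-∁-disjoint : ∀ {n} {S A : Subset n} → Disjoint S A → (S ∪ A) ∩ ∁ A ≡ S
∪-∩-∁-disjoint []                   = refl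
∪-∩-∁-disjoint (out∷_ {b = true} d)  = cong (false ∷_) (∪-∩-∁-disjoint d)
∪-∩-∁-disjoint (out∷_ {b = false} d) = cong (false ∷_) (∪-∩-∁-disjoint d)
∪-∩-∁-disjoint (in∷ d)              = cong (true ∷_) (∪-∩-∁-disjoint d)

module Theory {c ℓ : Level} (K : OrderedField c ℓ) where
  open OrderedField K
  open IsTotalOrder isTotalOrder using (total; antisym; isPartialOrder)

  commutativeRing : CommutativeRing c c
  commutativeRing = record { isCommutativeRing = isCommutativeRing }

  poset : Poset c c ℓ
  poset = record { isPartialOrder = isPartialOrder }

  open CommutativeRing commutativeRing
    using ( +-identityˡ; +-identityʳ; -‿inverseʳ; +-assoc; +-comm
          ; *-identityˡ; *-identityʳ; *-assoc; *-comm; zeroˡ; zeroʳ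
          ; distribˡ; distribʳ; ring; +-group; +-commutativeSemigroup)
  open RingProperties ring using (-‿distribˡ-*)
  open GroupProperties +-group using (⁻¹-involutive; ε⁻¹≈ε)
  open CommutativeSemigroupProperties +-commutativeSemigroup using (interchange)
  open PosetReasoning poset

  ≤-refl : ∀ {a} → a ≤ a
  ≤-refl = Poset.refl poset

  +-mono₂-≤ : ∀ {a b p q} → a ≤ b → p ≤ q → a + p ≤ b + q
  +-mono₂-≤ {a} {b} {p} {q} a≤b p≤q = begin
    a + p  ≤⟨ +-mono-≤ p a≤b ⟩
    b + p  ≡⟨ +-comm b p ⟩
    p + b  ≤⟨ +-mono-≤ b p≤q ⟩
    q + b  ≡⟨ +-comm q b ⟩
    b + q  ∎

  [a-b]+b≡a : ∀ a b → a - b + b ≡ a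
  [a-b]+b≡a a b = begin-equality
    a - b + b      ≡⟨ +-assoc a (- b) b ⟩
    a + (- b + b)  ≡⟨ cong (a +_) (trans (+-comm (- b) b) (-‿inverseʳ b)) ⟩
    a + 0#         ≡⟨ +-identityʳ a ⟩
    a              ∎

  [a+b]-b≡a : ∀ a b → a + b - b ≡ a
  [a+b]-b≡a a b = trans (+-assoc a b (- b)) (trans (cong (a +_) (-‿inverseʳ b)) (+-identityʳ a))

  ≤⇒0≤- : ∀ {p q} → p ≤ q → 0# ≤ q - p
  ≤⇒0≤- {p} {q} p≤q = begin
    0#     ≡⟨ sym (-‿inverseʳ p) ⟩
    p - p  ≤⟨ +-mono-≤ (- p) p≤q ⟩
    q - p  ∎

  *-monoˡ-≤-nonneg : ∀ {t p q} → 0# ≤ t → p ≤ q → t * p ≤ t * q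
  *-monoˡ-≤-nonneg {t} {p} {q} 0≤t p≤q = begin
    t * p                ≡⟨ sym (+-identityˡ (t * p)) ⟩
    0# + t * p           ≤⟨ +-mono-≤ (t * p) (*-nonneg 0≤t (≤⇒0≤- p≤q)) ⟩
    t * (q - p) + t * p  ≡⟨ sym (distribˡ t (q - p) p) ⟩
    t * (q - p + p)      ≡⟨ cong (t *_) ([a-b]+b≡a q p) ⟩
    t * q                ∎

  -- 0 ≤ 1: otherwise 0 ≤ -1, hence 0 ≤ (-1)(-1) = 1 and 0 = 1.
  0≤1 : 0# ≤ 1#
  0≤1 with total 0# 1#
  ... | inj₁ 0≤1 = 0≤1
  ... | inj₂ 1≤0 = ⊥-elim (0≢1 (antisym 0≤1′ 1≤0))
    where
    0≤-1 : 0# ≤ - 1#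
    0≤-1 = begin
      0#            ≡⟨ sym (-‿inverseʳ 1#) ⟩
      1# + - 1#     ≤⟨ +-mono-≤ (- 1#) 1≤0 ⟩
      0# + - 1#     ≡⟨ +-identityˡ (- 1#) ⟩
      - 1#          ∎
    0≤1′ : 0# ≤ 1#
    0≤1′ = begin
      0#                ≤⟨ *-nonneg 0≤-1 0≤-1 ⟩
      - 1# * - 1#       ≡⟨ sym (-‿distribˡ-* 1# (- 1#)) ⟩
      - (1# * - 1#)     ≡⟨ cong -_ (*-identityˡ (- 1#)) ⟩
      - (- 1#)          ≡⟨ ⁻¹-involutive 1# ⟩
      1#                ∎

  convex-lower-bound : ∀ {t a b v} → 0# ≤ t → 0# ≤ 1# - t → v ≤ a → v ≤ b →
    v ≤ t * a + (1# - t) * b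
  convex-lower-bound {t} {a} {b} {v} 0≤t 0≤1-t v≤a v≤b = begin
    v                          ≡⟨ sym (*-identityˡ v) ⟩
    1# * v                     ≡⟨ cong (_* v) (sym (trans (+-comm t (1# - t)) ([a-b]+b≡a 1# t))) ⟩
    (t + (1# - t)) * v         ≡⟨ distribʳ v t (1# - t) ⟩
    t * v + (1# - t) * v       ≤⟨ +-mono₂-≤ (*-monoˡ-≤-nonneg 0≤t v≤a) (*-monoˡ-≤-nonneg 0≤1-t v≤b) ⟩
    t * a + (1# - t) * b       ∎

  sumL-++ : ∀ xs ys → sumL K (xs ++ ys) ≡ sumL K xs + sumL K ys
  sumL-++ []       ys = sym (+-identityˡ _)
  sumL-++ (x ∷ xs) ys = trans (cong (x +_) (sumL-++ xs ys)) (sym (+-assoc x _ _))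

  sumL-factor : ∀ {A : Set} (t : Carrier) (h : A → Carrier) (L : List A) →
    sumL K (map (λ a → t * h a) L) ≡ t * sumL K (map h L)
  sumL-factor t h []      = sym (zeroʳ t)
  sumL-factor t h (a ∷ L) = trans (cong (t * h a +_) (sumL-factor t h L)) (sym (distribˡ t _ _))

  sumL-cong : ∀ {A : Set} {h h′ : A → Carrier} → (∀ a → h a ≡ h′ a) → (L : List A) →
    sumL K (map h L) ≡ sumL K (map h′ L)
  sumL-cong e []      = refl
  sumL-cong e (a ∷ L) = cong₂ _+_ (e a) (sumL-cong e L)

  F : {n : ℕ} → (Subset n → Carrier) → (Fin n → Carrier) → Carrier
  F = multilinear K

  F-empty : (g : Subset 0 → Carrier) (z : Fin 0 → Carrier) → F g z ≡ g []
  F-empty g z = trans (+-identityʳ _) (*-identityʳ _)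

  -- Conditioning on the first element: it is in R(z) with probability z₀.
  F-expand : ∀ {n} (g : Subset (sucℕ n) → Carrier) (z : Fin (sucℕ n) → Carrier) →
    F g z ≡ z fzero * F (g ∘ (true ∷_)) (z ∘ fsuc)
          + (1# - z fzero) * F (g ∘ (false ∷_)) (z ∘ fsuc)
  F-expand {n} g z = begin-equality
    sumL K (map term (map (true ∷_) L ++ map (false ∷_) L))
      ≡⟨ cong (sumL K) (map-++ term (map (true ∷_) L) (map (false ∷_) L)) ⟩
    sumL K (map term (map (true ∷_) L) ++ map term (map (false ∷_) L))
      ≡⟨ sumL-++ (map term (map (true ∷_) L)) _ ⟩
    sumL K (map term (map (true ∷_) L)) + sumL K (map term (map (false ∷_) L))
      ≡⟨ cong₂ _+_ (cong (sumL K) (sym (map-∘ L))) (cong (sumL K) (sym (map-∘ L))) ⟩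
    sumL K (map (term ∘ (true ∷_)) L) + sumL K (map (term ∘ (false ∷_)) L)
      ≡⟨ cong₂ _+_ (trans (sumL-cong (λ A → swap (g (true ∷ A)) _ _) L) (sumL-factor _ _ L))
                   (trans (sumL-cong (λ A → swap (g (false ∷ A)) _ _) L) (sumL-factor _ _ L)) ⟩
    z fzero * F (g ∘ (true ∷_)) (z ∘ fsuc) + (1# - z fzero) * F (g ∘ (false ∷_)) (z ∘ fsuc) ∎
    where
    L : List (Subset n)
    L = allSubsets n
    term : Subset (sucℕ n) → Carrier
    term A = g A * prob K z A
    swap : ∀ a b p → a * (b * p) ≡ b * (a * p)
    swap a b p = trans (sym (*-assoc a b p)) (trans (cong (_* p) (*-comm a b)) (*-assoc b a p))

  F-sure : ∀ {n} (g : Subset (sucℕ n) → Carrier) (z : Fin (sucℕ n) → Carrier) →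
    z fzero ≡ 1# → F g z ≡ F (g ∘ (true ∷_)) (z ∘ fsuc)
  F-sure g z z₀≡1 = begin-equality
    F g z                                   ≡⟨ F-expand g z ⟩
    z fzero * a + (1# - z fzero) * b        ≡⟨ cong (λ t → t * a + (1# - t) * b) z₀≡1 ⟩
    1# * a + (1# - 1#) * b                  ≡⟨ cong₂ _+_ (*-identityˡ a) (trans (cong (_* b) (-‿inverseʳ 1#)) (zeroˡ b)) ⟩
    a + 0#                                  ≡⟨ +-identityʳ a ⟩
    a                                       ∎
    where
    a = F (g ∘ (true ∷_)) (z ∘ fsuc)
    b = F (g ∘ (false ∷_)) (z ∘ fsuc)

  F-never : ∀ {n} (g : Subset (sucℕ n) → Carrier) (z : Fin (sucℕ n) → Carrier) →
    z fzero ≡ 0# → F g z ≡ F (g ∘ (false ∷_)) (z ∘ fsuc)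
  F-never g z z₀≡0 = begin-equality
    F g z                                   ≡⟨ F-expand g z ⟩
    z fzero * a + (1# - z fzero) * b        ≡⟨ cong (λ t → t * a + (1# - t) * b) z₀≡0 ⟩
    0# * a + (1# - 0#) * b                  ≡⟨ cong₂ _+_ (zeroˡ a) (trans (cong (λ m → (1# + m) * b) ε⁻¹≈ε)
                                                                        (cong (_* b) (+-identityʳ 1#))) ⟩
    0# + 1# * b                             ≡⟨ trans (+-identityˡ _) (*-identityˡ b) ⟩
    b                                       ∎
    where
    a = F (g ∘ (true ∷_)) (z ∘ fsuc)
    b = F (g ∘ (false ∷_)) (z ∘ fsuc)

  vanishOn : ∀ {n} → Subset n → (Fin n → Carrier) → Fin n → Carrier
  vanishOn S x u = if _∈?_ K u S then 0# else x u

  -- Sampling R(1_S ∨ x) and R(vanishOn S x) with shared coins outside S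
  -- yields S ∪ A and A for one random A disjoint from S; so a pointwise
  -- lower bound on g(S ∪ A) + h(A) bounds F g (1_S ∨ x) + F h (vanishOn S x).
  coupling : ∀ {n} (S : Subset n) (x : Fin n → Carrier) → InUnitCube K x →
    (g h : Subset n → Carrier) (v : Carrier) →
    (∀ A → Disjoint S A → v ≤ g (S ∪ A) + h A) →
    v ≤ F g (charJoin K S x) + F h (vanishOn S x)
  coupling [] x cube g h v bound = begin
    v                                     ≤⟨ bound [] [] ⟩
    g [] + h []                           ≡⟨ sym (cong₂ _+_ (F-empty g (charJoin K [] x)) (F-empty h (vanishOn [] x))) ⟩
    F g (charJoin K [] x) + F h (vanishOn [] x) ∎
  coupling (true ∷ S) x cube g h v bound = begin
    v                                     ≤⟨ coupling S (x ∘ fsuc) (cube ∘ fsuc) _ _ v (λ A d → bound (false ∷ A) (in∷ d)) ⟩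
    F (g ∘ (true ∷_)) (charJoin K S (x ∘ fsuc)) + F (h ∘ (false ∷_)) (vanishOn S (x ∘ fsuc))
                                          ≡⟨ sym (cong₂ _+_ (F-sure g (charJoin K (true ∷ S) x) refl)
                                                              (F-never h (vanishOn (true ∷ S) x) refl)) ⟩
    F g (charJoin K (true ∷ S) x) + F h (vanishOn (true ∷ S) x) ∎
  coupling (false ∷ S) x cube g h v bound = begin
    v                                     ≤⟨ convex-lower-bound (proj₁ (cube fzero)) (≤⇒0≤- (proj₂ (cube fzero)))
                                               (IH true) (IH false) ⟩
    t * (a₁ + a₂) + (1# - t) * (b₁ + b₂)  ≡⟨ cong₂ _+_ (distribˡ t a₁ a₂) (distribˡ (1# - t) b₁ b₂) ⟩
    (t * a₁ + t * a₂) + ((1# - t) * b₁ + (1# - t) * b₂)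
                                          ≡⟨ interchange (t * a₁) (t * a₂) _ _ ⟩
    (t * a₁ + (1# - t) * b₁) + (t * a₂ + (1# - t) * b₂)
                                          ≡⟨ sym (cong₂ _+_ (F-expand g (charJoin K (false ∷ S) x))
                                                              (F-expand h (vanishOn (false ∷ S) x))) ⟩
    F g (charJoin K (false ∷ S) x) + F h (vanishOn (false ∷ S) x) ∎
    where
    t  = x fzero
    a₁ = F (g ∘ (true ∷_)) (charJoin K S (x ∘ fsuc))
    b₁ = F (g ∘ (false ∷_)) (charJoin K S (x ∘ fsuc))
    a₂ = F (h ∘ (true ∷_)) (vanishOn S (x ∘ fsuc))
    b₂ = F (h ∘ (false ∷_)) (vanishOn S (x ∘ fsuc))
    IH : (b : Bool) → v ≤ F (g ∘ (b ∷_)) (charJoin K S (x ∘ fsuc)) + F (h ∘ (b ∷_)) (vanishOn S (x ∘ fsuc))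
    IH b = coupling S (x ∘ fsuc) (cube ∘ fsuc) _ _ v (λ A d → bound (b ∷ A) (out∷ d))

  vanishOn-cube : ∀ {n} (S : Subset n) (x : Fin n → Carrier) → InUnitCube K x → InUnitCube K (vanishOn S x)
  vanishOn-cube S x cube u with _∈?_ K u S
  ... | true  = ≤-refl , 0≤1
  ... | false = cube u

  vanishOn-≤ : ∀ {n} (S : Subset n) (x : Fin n → Carrier) → InUnitCube K x → ∀ u → vanishOn S x u ≤ x u
  vanishOn-≤ S x cube u with _∈?_ K u S
  ... | true  = proj₁ (cube u)
  ... | false = ≤-refl

  disjoint-lower-bound : ∀ {n} (f : Subset n → Carrier) →
    NonNegative K f → Symmetric K f → Submodular K f →
    ∀ {S A} → Disjoint S A → f S ≤ f (S ∪ A) + f A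
  disjoint-lower-bound f nonneg symmetric submodular {S} {A} d = begin
    f S                                      ≡⟨ sym (+-identityˡ (f S)) ⟩
    0# + f S                                 ≤⟨ +-mono-≤ (f S) (nonneg _) ⟩
    f ((S ∪ A) ∪ ∁ A) + f S                  ≡⟨ cong (λ B → f ((S ∪ A) ∪ ∁ A) + f B) (sym (∪-∩-∁-disjoint d)) ⟩
    f ((S ∪ A) ∪ ∁ A) + f ((S ∪ A) ∩ ∁ A)    ≤⟨ submodular (S ∪ A) (∁ A) ⟩
    f (S ∪ A) + f (∁ A)                      ≡⟨ cong (f (S ∪ A) +_) (sym (symmetric A)) ⟩
    f (S ∪ A) + f A                          ∎

lemma1p7 : {c ℓ : Level} (K : OrderedField c ℓ) (n : ℕ)
    (f : Subset n → OrderedField.Carrier K) →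
    NonNegative K f → Symmetric K f → Submodular K f →
    (S : Subset n) (x : Fin n → OrderedField.Carrier K) →
    InUnitCube K x →
    ((y : Fin n → OrderedField.Carrier K) → InUnitCube K y →
    (∀ u → OrderedField._≤_ K (y u) (x u)) →
    OrderedField._≤_ K (multilinear K f y) (multilinear K f x)) →
    OrderedField._≤_ K
    (OrderedField._-_ K (f S) (multilinear K f x))
    (multilinear K f (charJoin K S x))
lemma1p7 K n f nonneg symmetric submodular S x cube locallyMaximal = begin
  f S - F f x                          ≤⟨ +-mono-≤ (- F f x) fS≤ ⟩
  F f (charJoin K S x) + F f x - F f x ≡⟨ [a+b]-b≡a _ _ ⟩
  F f (charJoin K S x)                 ∎
  where
  open OrderedField K
  open Theory K
  open PosetReasoning poset
  y : Fin n → Carrier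
  y = vanishOn S x
  fS≤ : f S ≤ F f (charJoin K S x) + F f x
  fS≤ = begin
    f S                           ≤⟨ coupling S x cube f f (f S) (λ A → disjoint-lower-bound f nonneg symmetric submodular) ⟩
    F f (charJoin K S x) + F f y  ≤⟨ +-mono₂-≤ ≤-refl
                                      (locallyMaximal y (vanishOn-cube S x cube) (vanishOn-≤ S x cube)) ⟩
    F f (charJoin K S x) + F f x  ∎
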